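{- Let $H$ be a simple graph and let $G=2H$ be the signed graph obtained from $H$ by replacing every edge of $H$ by a pair of parallel edges, one positive and one negative. Then $\chi^{\pm}(G)=2\chi(H)-1$.
   Context: A signed graph is a finite graph (multiple edges allowed, no loops) together with a sign map $\sigma$ assigning $+1$ or $-1$ to each edge. A coloring of a signed graph $G$ is a map $\phi:V(G)\to\mathbb{Z}$ such that every edge $e$ with ends $v,w$ satisfies $\phi(v)\neq\sigma(e)\phi(w)$. For an integer $h\ge 0$ let $Z_{2h}=\{\pm1,\pm2,\dots,\pm h\}$ and $Z_{2h+1}=Z_{2h}\cup\{0\}$. The signed chromatic number $\chi^{\pm}(G)$ is the least integer $k$ such that $G$ has a coloring $\phi$ with $\phi(V(G))\subseteq Z_k$. $\chi(H)$ is the ordinary chromatic number. -}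

module Defs where

open import Data.Nat using (ℕ; _≤_; _*_; suc)
open import Data.Integer as ℤ using (ℤ; ∣_∣; -_)
open import Data.Fin using (Fin)
open import Data.Product using (Σ; _×_; _,_; proj₁; proj₂)
open import Data.Sum using (_⊎_)
open import Data.Sign using (Sign)
open import Relation.Binary.PropositionalEquality using (_≡_; _≢_)

record SimpleGraph : Set where
  field
    n    : ℕ
    m    : ℕ
    end₁ : Fin m → Fin n
    end₂ : Fin m → Fin n
    loopless : ∀ e → end₁ e ≢ end₂ e
    noParallel : ∀ e f →
      (end₁ e ≡ end₁ f × end₂ e ≡ end₂ f) ⊎ (end₁ e ≡ end₂ f × end₂ e ≡ end₁ f) →
      e ≡ f

Colorable : SimpleGraph → ℕ → Set
Colorable H k = Σ (Fin n → Fin k) λ c → ∀ e → c (end₁ e) ≢ c (end₂ e)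
  where open SimpleGraph H

IsChromaticNumber : SimpleGraph → ℕ → Set
IsChromaticNumber H c = Colorable H c × (∀ k → Colorable H k → c ≤ k)

record SignedGraph : Set₁ where
  field
    n    : ℕ
    E    : Set
    end₁ : E → Fin n
    end₂ : E → Fin n
    sign : E → Sign
    loopless : ∀ e → end₁ e ≢ end₂ e

_·_ : Sign → ℤ → ℤ
Sign.+ · x = x
Sign.- · x = - x

IsSignedColoring : (G : SignedGraph) → (Fin (SignedGraph.n G) → ℤ) → Set
IsSignedColoring G φ = ∀ e → φ (end₁ e) ≢ sign e · φ (end₂ e)
  where open SignedGraph G

-- Z_k : Z_{2h} = {±1,…,±h},  Z_{2h+1} = Z_{2h} ∪ {0}
InZ : ℕ → ℤ → Set
InZ k x =
  Σ ℕ λ h → (k ≡ h * 2 × x ≢ ℤ.+ 0 × ∣ x ∣ ≤ h)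
          ⊎ (k ≡ suc (h * 2) × ∣ x ∣ ≤ h)

SignedColorable : SignedGraph → ℕ → Set
SignedColorable G k =
  Σ (Fin (SignedGraph.n G) → ℤ) λ φ → IsSignedColoring G φ × (∀ v → InZ k (φ v))

IsSignedChromaticNumber : SignedGraph → ℕ → Set
IsSignedChromaticNumber G c = SignedColorable G c × (∀ k → SignedColorable G k → c ≤ k)

double : SimpleGraph → SignedGraph
double H = record
  { n = n
  ; E = Fin m × Sign
  ; end₁ = λ p → end₁ (proj₁ p)
  ; end₂ = λ p → end₂ (proj₁ p)
  ; sign = proj₂
  ; loopless = λ p → loopless (proj₁ p)
  }
  where open SimpleGraph H

-- Since φ(v) ≠ φ(w) and φ(v) ≠ −φ(w) together say ∣φ(v)∣ ≠ ∣φ(w)∣, a signed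
-- colouring of 2H into Z_k is the same as a proper colouring of H by the
-- absolute values of Z_k.  There are ⌈k/2⌉ of them, so χ^±(2H) is the least k
-- with χ(H) ≤ ⌈k/2⌉, namely 2χ(H) − 1.
module Submission where

open import Defs
open import Data.Nat using (ℕ; zero; suc; _+_; _*_; _∸_; _≤_; _<_; s≤s; z≤n; ⌊_/2⌋; ⌈_/2⌉)
open import Data.Nat.Properties
  using (≤-refl; ≤-pred; +-suc; *-suc; *-comm; *-monoʳ-≤; ∸-monoˡ-≤; ∸-monoʳ-<;
         ∸-cancelˡ-≡; m∸n≤m; n≢0⇒n>0; module ≤-Reasoning)
open import Data.Integer using (ℤ; +_; -[1+_]; -_; ∣_∣)
open import Data.Integer.Properties using (∣-i∣≡∣i∣; ∣i∣≡0⇒i≡0)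
open import Data.Fin using (Fin; toℕ; fromℕ<)
open import Data.Fin.Properties using (toℕ<n; toℕ-fromℕ<; toℕ-injective)
open import Data.Product using (_×_; _,_; proj₁; proj₂)
open import Data.Sum using (_⊎_; inj₁; inj₂)
open import Data.Sign using (Sign)
open import Function.Bundles using (_⇔_; mk⇔; Equivalence)
open import Relation.Binary.PropositionalEquality using (_≡_; _≢_; refl; sym; trans; cong; subst)

∣i∣≡∣j∣⇒i≡j⊎i≡-j : ∀ i j → ∣ i ∣ ≡ ∣ j ∣ → i ≡ j ⊎ i ≡ - j
∣i∣≡∣j∣⇒i≡j⊎i≡-j (+ a)    (+ b)        eq   = inj₁ (cong +_ eq)
∣i∣≡∣j∣⇒i≡j⊎i≡-j (+ a)    -[1+ b ]     eq   = inj₂ (cong +_ eq)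
∣i∣≡∣j∣⇒i≡j⊎i≡-j -[1+ a ] (+ zero)     ()
∣i∣≡∣j∣⇒i≡j⊎i≡-j -[1+ a ] (+ suc b)    refl = inj₂ refl
∣i∣≡∣j∣⇒i≡j⊎i≡-j -[1+ a ] -[1+ b ]     refl = inj₁ refl

∣i∣≡∣σ·i∣ : ∀ σ i → ∣ i ∣ ≡ ∣ σ · i ∣
∣i∣≡∣σ·i∣ Sign.+ i = refl
∣i∣≡∣σ·i∣ Sign.- i = sym (∣-i∣≡∣i∣ i)

⌊n*2/2⌋≡n : ∀ n → ⌊ n * 2 /2⌋ ≡ n
⌊n*2/2⌋≡n zero    = refl
⌊n*2/2⌋≡n (suc n) = cong suc (⌊n*2/2⌋≡n n)

⌈n*2/2⌉≡n : ∀ n → ⌈ n * 2 /2⌉ ≡ n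
⌈n*2/2⌉≡n zero    = refl
⌈n*2/2⌉≡n (suc n) = cong suc (⌈n*2/2⌉≡n n)

2*⌈n/2⌉≤1+n : ∀ n → 2 * ⌈ n /2⌉ ≤ suc n
2*⌈n/2⌉≤1+n zero          = z≤n
2*⌈n/2⌉≤1+n (suc zero)    = ≤-refl
2*⌈n/2⌉≤1+n (suc (suc n)) =
  subst (_≤ suc (suc (suc n))) (sym (*-suc 2 ⌈ n /2⌉)) (s≤s (s≤s (2*⌈n/2⌉≤1+n n)))

m≤⌈n/2⌉⇒2*m∸1≤n : ∀ {m} n → m ≤ ⌈ n /2⌉ → 2 * m ∸ 1 ≤ n
m≤⌈n/2⌉⇒2*m∸1≤n {m} n m≤⌈n/2⌉ = begin
  2 * m ∸ 1         ≤⟨ ∸-monoˡ-≤ 1 (*-monoʳ-≤ 2 m≤⌈n/2⌉) ⟩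
  2 * ⌈ n /2⌉ ∸ 1   ≤⟨ ∸-monoˡ-≤ 1 (2*⌈n/2⌉≤1+n n) ⟩
  n                 ∎
  where open ≤-Reasoning

2*[1+m]∸1≡1+m*2 : ∀ m → 2 * suc m ∸ 1 ≡ suc (m * 2)
2*[1+m]∸1≡1+m*2 m = trans (+-suc m (m + 0)) (cong suc (*-comm 2 m))

InZ-2*m∸1 : ∀ {a m} → a < m → InZ (2 * m ∸ 1) (+ a)
InZ-2*m∸1 {m = suc m} a<1+m = m , inj₂ (2*[1+m]∸1≡1+m*2 m , ≤-pred a<1+m)

-- Reflection at ⌊k/2⌋ maps the absolute values occurring in Z_k (which omit 0
-- when k is even) into {0, …, ⌈k/2⌉ − 1}.
InZ⇒∣x∣≤⌊k/2⌋ : ∀ {k x} → InZ k x → ∣ x ∣ ≤ ⌊ k /2⌋ × ⌊ k /2⌋ ∸ ∣ x ∣ < ⌈ k /2⌉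
InZ⇒∣x∣≤⌊k/2⌋ (h , inj₁ (refl , x≢0 , ∣x∣≤h))
  rewrite ⌊n*2/2⌋≡n h | ⌈n*2/2⌉≡n h =
    ∣x∣≤h , ∸-monoʳ-< (n≢0⇒n>0 (λ ∣x∣≡0 → x≢0 (∣i∣≡0⇒i≡0 ∣x∣≡0))) ∣x∣≤h
InZ⇒∣x∣≤⌊k/2⌋ {x = x} (h , inj₂ (refl , ∣x∣≤h))
  rewrite ⌊n*2/2⌋≡n h | ⌈n*2/2⌉≡n h = ∣x∣≤h , s≤s (m∸n≤m h ∣ x ∣)

module _ (H : SimpleGraph) where
  open SimpleGraph H

  colorable-fromℕ : ∀ {K} (f : Fin n → ℕ) → (∀ v → f v < K) →
    (∀ e → f (end₁ e) ≢ f (end₂ e)) → Colorable H K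
  colorable-fromℕ f f<K proper = (λ v → fromℕ< (f<K v)) , λ e eq →
    proper e (trans (sym (toℕ-fromℕ< (f<K _))) (trans (cong toℕ eq) (toℕ-fromℕ< (f<K _))))

  isSignedColoring-double⇔ : (φ : Fin n → ℤ) →
    IsSignedColoring (double H) φ ⇔ (∀ e → ∣ φ (end₁ e) ∣ ≢ ∣ φ (end₂ e) ∣)
  isSignedColoring-double⇔ φ = mk⇔ absProper signed
    where
    absProper : IsSignedColoring (double H) φ → ∀ e → ∣ φ (end₁ e) ∣ ≢ ∣ φ (end₂ e) ∣
    absProper sc e eq with ∣i∣≡∣j∣⇒i≡j⊎i≡-j _ _ eq
    ... | inj₁ φv≡φw  = sc (e , Sign.+) φv≡φw
    ... | inj₂ φv≡-φw = sc (e , Sign.-) φv≡-φw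

    signed : (∀ e → ∣ φ (end₁ e) ∣ ≢ ∣ φ (end₂ e) ∣) → IsSignedColoring (double H) φ
    signed proper (e , σ) eq = proper e (trans (cong ∣_∣ eq) (sym (∣i∣≡∣σ·i∣ σ _)))

  signedColorable-double : ∀ {c} → Colorable H c → SignedColorable (double H) (2 * c ∸ 1)
  signedColorable-double (col , proper) =
    φ , Equivalence.from (isSignedColoring-double⇔ φ) (λ e eq → proper e (toℕ-injective eq)) ,
    λ v → InZ-2*m∸1 (toℕ<n (col v))
    where
    φ : Fin n → ℤ
    φ v = + toℕ (col v)

  colorable-⌈k/2⌉ : ∀ {k} → SignedColorable (double H) k → Colorable H ⌈ k /2⌉
  colorable-⌈k/2⌉ {k} (ψ , sc , inZ) =
    colorable-fromℕ (λ v → ⌊ k /2⌋ ∸ ∣ ψ v ∣) (λ v → proj₂ (bounds v)) λ e eq →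
      Equivalence.to (isSignedColoring-double⇔ ψ) sc e
        (∸-cancelˡ-≡ (proj₁ (bounds _)) (proj₁ (bounds _)) eq)
    where
    bounds : ∀ v → ∣ ψ v ∣ ≤ ⌊ k /2⌋ × ⌊ k /2⌋ ∸ ∣ ψ v ∣ < ⌈ k /2⌉
    bounds v = InZ⇒∣x∣≤⌊k/2⌋ (inZ v)

theorem3 : (H : SimpleGraph) (c : ℕ) → IsChromaticNumber H c →
    IsSignedChromaticNumber (double H) (2 * c ∸ 1)
theorem3 H c (colorable , minimal) =
  signedColorable-double H colorable ,
  λ k signedColorable → m≤⌈n/2⌉⇒2*m∸1≤n k (minimal ⌈ k /2⌉ (colorable-⌈k/2⌉ H signedColorable))
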